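{- Let $a<b$ be coprime positive integers. Then (1) the simplicial complex $\mathsf{Ass}(a,b)$ is pure of dimension $a-2$; and (2) the number of facets of $\mathsf{Ass}(a,b)$ is $\frac{(a+b-1)!}{a!\,b!}$.
   Context: An $(a,b)$-Dyck path is a lattice path from $(0,0)$ to $(b,a)$ with unit north and east steps that stays above the line $y=\frac{a}{b}x$ (meeting it only at its endpoints). For such a path $D$ and a lattice point $P\neq(0,0)$ of $D$ which is the bottom of a north step, the laser $\ell(P)$ is the segment of slope $a/b$ from $P$ going northeast up to the first point beyond $P$ where it meets $D$; this endpoint lies in the interior of an east step of $D$ whose right endpoint is called $Q$. Label the vertices of a convex $(b+1)$-gon $\mathbb{P}_{b+1}$ by $1,\dots,b+1$ clockwise and let $e(P)$ be the diagonal joining vertices $i+1$ and $j+1$ where $i,j$ are the $x$-coordinates of $P,Q$. Let $F(D)=\{e(P)\}$ over all such $P$. $\mathsf{Ass}(a,b)$ is the simplicial complex whose facets are the sets $F(D)$ for all $(a,b)$-Dyck paths $D$. -}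

module Defs where

open import Data.Nat using (ℕ; zero; suc; _+_; _*_; _∸_; _<_; _⊓_; _⊔_; _<?_)
import Data.Nat.Properties as ℕP
open import Data.Integer as ℤ using (ℤ; +_)
open import Data.List using (List; []; _∷_; filter; map; mapMaybe; head; concatMap; deduplicate; length)
open import Data.List.Relation.Unary.All using (All; all?)
open import Data.List.Relation.Unary.Any using (any?)
open import Data.List.Membership.Propositional using (_∈_)
open import Data.List.Membership.DecPropositional using () renaming (_∈?_ to mem?)
open import Data.Maybe using (Maybe; just; nothing)
open import Data.Product using (_×_; _,_)
open import Data.Product.Properties using (≡-dec)
open import Relation.Binary.PropositionalEquality using (_≡_)
open import Relation.Binary.Definitions using (DecidableEquality)
open import Relation.Nullary using (Dec; ¬_; ¬?; yes; no)
open import Relation.Nullary.Decidable using (_×-dec_; _→-dec_)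

data Step : Set where
  N E : Step

Point : Set
Point = ℕ × ℕ

_≟P_ : DecidableEquality Point
_≟P_ = ≡-dec ℕP._≟_ ℕP._≟_

move : Step → Point → Point
move N (x , y) = x , suc y
move E (x , y) = suc x , y

countN countE : List Step → ℕ
countN []      = 0
countN (N ∷ w) = suc (countN w)
countN (E ∷ w) = countN w
countE []      = 0
countE (N ∷ w) = countE w
countE (E ∷ w) = suc (countE w)

interiorPts : Point → List Step → List Point
interiorPts p []          = []
interiorPts p (s ∷ [])    = []
interiorPts p (s ∷ t ∷ w) = move s p ∷ interiorPts (move s p) (t ∷ w)

StrictlyAbove : ℕ → ℕ → Point → Set
StrictlyAbove a b (x , y) = a * x < b * y

-- An (a,b)-Dyck path: from (0,0) to (b,a) (a north steps, b east steps),
-- staying strictly above y = (a/b) x except at its two endpoints.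
-- (Between consecutive lattice points the path is a segment, so it is
-- strictly above the line iff all interior lattice points are.)
IsDyck : ℕ → ℕ → List Step → Set
IsDyck a b w = (countN w ≡ a) × (countE w ≡ b) × All (StrictlyAbove a b) (interiorPts (0 , 0) w)

isDyck? : ∀ a b w → Dec (IsDyck a b w)
isDyck? a b w = (countN w ℕP.≟ a) ×-dec (countE w ℕP.≟ b)
                ×-dec all? (λ { (x , y) → a * x <? b * y }) (interiorPts (0 , 0) w)

words : ℕ → List (List Step)
words zero    = [] ∷ []
words (suc n) = concatMap (λ w → (N ∷ w) ∷ (E ∷ w) ∷ []) (words n)

dyckPaths : ℕ → ℕ → List (List Step)
dyckPaths a b = filter (isDyck? a b) (words (a + b))

northBottoms : Point → List Step → List Point
northBottoms p []      = []
northBottoms p (N ∷ w) = p ∷ northBottoms (move N p) w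
northBottoms p (E ∷ w) = northBottoms (move E p) w

eastLefts : Point → List Step → List Point
eastLefts p []      = []
eastLefts p (N ∷ w) = eastLefts (move N p) w
eastLefts p (E ∷ w) = p ∷ eastLefts (move E p) w

laserSources : List Step → List Point
laserSources w = filter (λ p → ¬? (p ≟P (0 , 0))) (northBottoms (0 , 0) w)

-- The laser of slope a/b from P = (x0 , y0) passes through the interior
-- of the east step from (k , y) to (k+1 , y), beyond P:
-- its point at height y has x = x0 + b (y - y0) / a ∈ (k , k+1).
LaserHits : ℕ → ℕ → Point → Point → Set
LaserHits a b (x0 , y0) (k , y) =
  (y0 < y) × (a * k < a * x0 + b * (y ∸ y0)) × (a * x0 + b * (y ∸ y0) < a * suc k)

laserHits? : ∀ a b P E → Dec (LaserHits a b P E)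
laserHits? a b (x0 , y0) (k , y) =
  (y0 <? y) ×-dec (a * k <? a * x0 + b * (y ∸ y0)) ×-dec (a * x0 + b * (y ∸ y0) <? a * suc k)

-- The east step containing the end of the laser ℓ(P): the first east step
-- (in path order, equivalently lowest) whose interior the laser meets.
-- Returns its left endpoint.
laserStep : ℕ → ℕ → List Step → Point → Maybe Point
laserStep a b w P = head (filter (laserHits? a b P) (eastLefts (0 , 0) w))

-- Diagonals of the (b+1)-gon with vertices 1..b+1: unordered pairs,
-- stored normalised as (smaller , larger).
Diagonal : Set
Diagonal = ℕ × ℕ

diag : ℕ → ℕ → Diagonal
diag i j = (i ⊓ j , i ⊔ j)

-- e(P) joins vertices i+1 and j+1, where i = x(P), j = x(Q), Q the right
-- endpoint (k+1 , y) of the east step hit by the laser.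
e : ℕ → ℕ → List Step → Point → Maybe Diagonal
e a b w P with laserStep a b w P
... | nothing      = nothing
... | just (k , y) = just (diag (suc (Data.Product.proj₁ P)) (suc (suc k)))

F : ℕ → ℕ → List Step → List Diagonal
F a b w = mapMaybe (e a b w) (laserSources w)

_⊆ˢ_ : List Diagonal → List Diagonal → Set
S ⊆ˢ T = All (λ x → x ∈ T) S

_⊆ˢ?_ : ∀ S T → Dec (S ⊆ˢ T)
S ⊆ˢ? T = all? (λ x → mem? _≟P_ x T) S

_≈ˢ_ : List Diagonal → List Diagonal → Set
S ≈ˢ T = (S ⊆ˢ T) × (T ⊆ˢ S)

_≈ˢ?_ : ∀ S T → Dec (S ≈ˢ T)
S ≈ˢ? T = (S ⊆ˢ? T) ×-dec (T ⊆ˢ? S)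

card : List Diagonal → ℕ
card S = length (deduplicate _≟P_ S)

dim : List Diagonal → ℤ
dim S = + card S ℤ.- + 1

generators : ℕ → ℕ → List (List Diagonal)
generators a b = map (F a b) (dyckPaths a b)

Maximal : List (List Diagonal) → List Diagonal → Set
Maximal Gs S = All (λ T → S ⊆ˢ T → T ⊆ˢ S) Gs

maximal? : ∀ Gs S → Dec (Maximal Gs S)
maximal? Gs S = all? (λ T → (S ⊆ˢ? T) →-dec (T ⊆ˢ? S)) Gs

-- The facets of Ass(a,b) (the simplicial complex generated by the sets
-- F(D)): the inclusion-maximal generators, each set listed once.
facets : ℕ → ℕ → List (List Diagonal)
facets a b = deduplicate _≈ˢ?_ (filter (maximal? (generators a b)) (generators a b))

PureOfDimension : List (List Diagonal) → ℤ → Set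
PureOfDimension Fs d = All (λ S → dim S ≡ d) Fs

-- Every bottom P ≠ (0,0) of a north step of a Dyck path D lies strictly above the line
-- y = (a/b) x, and there are a − 1 of them.  Since gcd(a,b) = 1 a laser never meets a lattice
-- point, so ℓ(P) ends inside an east step; since a < b, lasers from two points of the same
-- column end on different east steps.  Hence e is injective and |F(D)| = a − 1.  The smaller
-- vertex of e(P) is x(P) + 1, so F(D) records how many north steps D has on each vertical
-- line, and these numbers determine D.  So distinct Dyck paths give incomparable sets F(D),
-- which are therefore exactly the facets, all of dimension a − 2.
--
-- For the count, give a north step weight b and an east step weight −a.  A word with a north
-- and b east steps has weight 0 and, by coprimality, its proper prefixes have distinct
-- weights; the rotation cutting after the prefix of least weight is the only rotation that is
-- a Dyck path (cycle lemma).  So the a + b rotations of all Dyck paths list every such word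
-- exactly once: (a + b) · #Dyck = C(a + b, a), whence #Dyck = (a + b − 1)! / (a! b!).

module Submission where

open import Defs
open import Data.Nat as ℕ
  using (ℕ; zero; suc; _+_; _*_; _∸_; _<_; _≤_; z≤n; s≤s; _<?_; _≟_; _!; NonZero)
open import Data.Nat.Properties
open import Data.Nat.Coprimality using (Coprime; coprime-divisor)
open import Data.Nat.Divisibility using (_∣_; divides; ∣m+n∣m⇒∣n; ∣⇒≤)
open import Data.Nat.Combinatorics using (_C_; nCk≡n!/k![n-k]!; k![n∸k]!∣n!; nCk+nC[k+1]≡[n+1]C[k+1])
open import Data.Nat.DivMod using (m/n*n≡m)
open import Data.Integer as ℤ using (ℤ; +_; -_; 0ℤ; +<+)
import Data.Integer.Properties as ℤP
open import Data.Integer.Tactic.RingSolver using (solve-∀)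
import Data.Nat.Tactic.RingSolver as ℕ-Solver
open import Data.Bool using (true; false; if_then_else_)
open import Data.List
  using (List; []; _∷_; _++_; length; filter; map; mapMaybe; head; concatMap; deduplicate;
         take; drop; upTo; cartesianProduct)
open import Data.List.Properties
  using (length-++; length-map; filter-all; filter-none; filter-accept; filter-reject;
         ++-assoc; ++-identityʳ; ++-cancelˡ; ++-identityʳ-unique; ++-conicalʳ; ∷-injective;
         take++drop≡id; length-take; length-drop; length-upTo)
open import Data.List.Relation.Unary.All as All using (All; []; _∷_)
open import Data.List.Relation.Unary.All.Properties using (¬Any⇒All¬; map⁺)
open import Data.List.Relation.Unary.Any using (Any; here; there)
open import Data.List.Relation.Unary.AllPairs using (AllPairs; []; _∷_)
open import Data.List.Relation.Unary.Unique.Propositional using (Unique)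
import Data.List.Relation.Unary.Unique.Propositional.Properties as Unique
open import Data.List.Relation.Binary.Subset.Propositional using (_⊆_)
open import Data.List.Relation.Binary.Subset.Propositional.Properties using (Any-resp-⊆; filter⁺′)
open import Data.List.Membership.Propositional using (_∈_; _∉_; find; lose)
open import Data.List.Membership.Propositional.Properties
  using (∈-++⁻; ∈-++⁺ˡ; ∈-++⁺ʳ; ∈-∃++; ∈-filter⁻; ∈-filter⁺; ∈-map⁺; ∈-map⁻;
         ∈-cartesianProduct⁺; ∈-cartesianProduct⁻; ∈-upTo⁺; ∈-upTo⁻; ∈-concatMap⁺; ∈-concatMap⁻)
open import Data.List.Relation.Binary.Disjoint.Propositional using (Disjoint)
open import Data.List.Membership.DecPropositional using () renaming (_∈?_ to mem?)
open import Data.Maybe using (Maybe; just; nothing)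
open import Data.Maybe.Properties using (just-injective)
open import Data.Product using (_×_; _,_; proj₁; proj₂; ∃)
open import Data.Sum using (_⊎_; inj₁; inj₂; [_,_]′)
open import Data.Empty using (⊥; ⊥-elim)
open import Function using (_∘_; id)
open import Level using (0ℓ)
open import Relation.Binary.Core using (Rel)
open import Relation.Binary.Definitions using (DecidableEquality; tri<; tri≈; tri>)
import Relation.Binary.Definitions as B
open import Relation.Binary.PropositionalEquality
  using (_≡_; _≢_; refl; sym; trans; cong; cong₂; subst; subst₂; module ≡-Reasoning)
open import Relation.Nullary using (¬_; ¬?; yes; no; does; contradiction)
open import Relation.Unary using (Pred; Decidable)
open import Algebra.Properties.AbelianGroup ℤP.+-0-abelianGroup using (identityʳ-unique)

module _ {A : Set} where

  length-++-∷ : ∀ (l : List A) x r → length (l ++ x ∷ r) ≡ suc (length (l ++ r))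
  length-++-∷ []      x r = refl
  length-++-∷ (y ∷ l) x r = cong suc (length-++-∷ l x r)

  ⊆-delete : ∀ {x} {xs : List A} l r → x ∉ xs → xs ⊆ l ++ x ∷ r → xs ⊆ l ++ r
  ⊆-delete l r x∉xs xs⊆ y∈xs with ∈-++⁻ l (xs⊆ y∈xs)
  ... | inj₁ y∈l         = ∈-++⁺ˡ y∈l
  ... | inj₂ (here refl) = contradiction y∈xs x∉xs
  ... | inj₂ (there y∈r) = ∈-++⁺ʳ l y∈r

  Unique⇒∉ : ∀ {x} {xs : List A} → Unique (x ∷ xs) → x ∉ xs
  Unique⇒∉ (x≢xs ∷ _) x∈xs = All.lookup x≢xs x∈xs refl

  Unique-⊆⇒length≤ : ∀ {xs ys : List A} → Unique xs → xs ⊆ ys → length xs ≤ length ys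
  Unique-⊆⇒length≤ {[]}     _           _    = z≤n
  Unique-⊆⇒length≤ {x ∷ xs} u@(_ ∷ uxs) xs⊆ with ∈-∃++ (xs⊆ (here refl))
  ... | l , r , refl =
    subst (suc (length xs) ≤_) (sym (length-++-∷ l x r))
      (s≤s (Unique-⊆⇒length≤ uxs (⊆-delete l r (Unique⇒∉ u) (xs⊆ ∘ there))))

  Unique-⊆-⊇⇒length≡ : ∀ {xs ys : List A} → Unique xs → Unique ys → xs ⊆ ys → ys ⊆ xs →
                       length xs ≡ length ys
  Unique-⊆-⊇⇒length≡ uxs uys xs⊆ys ys⊆xs =
    ≤-antisym (Unique-⊆⇒length≤ uxs xs⊆ys) (Unique-⊆⇒length≤ uys ys⊆xs)

  Unique-⊆-length≥⇒⊇ : DecidableEquality A → ∀ {xs ys : List A} → Unique xs → xs ⊆ ys →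
                       length ys ≤ length xs → ys ⊆ xs
  Unique-⊆-length≥⇒⊇ _≟_ {xs} uxs xs⊆ys ys≤xs {y} y∈ys with mem? _≟_ y xs
  ... | yes y∈xs = y∈xs
  ... | no  y∉xs = contradiction ys≤xs (<⇒≱
    (Unique-⊆⇒length≤ (¬Any⇒All¬ xs y∉xs ∷ uxs) λ { (here refl) → y∈ys ; (there m) → xs⊆ys m }))

  deduplicate-AllPairs : ∀ {R : Rel A 0ℓ} (R? : B.Decidable R) xs →
                         AllPairs (λ x y → ¬ R x y) xs → deduplicate R? xs ≡ xs
  deduplicate-AllPairs R? []       []         = refl
  deduplicate-AllPairs R? (x ∷ xs) (x≁ ∷ xs≁) rewrite deduplicate-AllPairs R? xs xs≁ =
    cong (x ∷_) (filter-all (¬? ∘ R? x) x≁)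

  AllPairs-map-∈ : ∀ {B : Set} {R : Rel A 0ℓ} {S : Rel B 0ℓ} (f : A → B) {xs : List A} →
                   (∀ {x y} → x ∈ xs → y ∈ xs → R x y → S (f x) (f y)) →
                   AllPairs R xs → AllPairs S (map f xs)
  AllPairs-map-∈ f {[]}     _    []       = []
  AllPairs-map-∈ {S = S} f {x ∷ xs} mono (rx ∷ rxs) =
    All.tabulate (λ m → let (y , y∈ , fy≡) = ∈-map⁻ f m in
                         subst (S (f x)) (sym fy≡) (mono (here refl) (there y∈) (All.lookup rx y∈)))
    ∷ AllPairs-map-∈ f (λ m m′ → mono (there m) (there m′)) rxs

  head-filter-Any : ∀ {P : Pred A 0ℓ} (P? : Decidable P) xs → Any P xs →
                    ∃ λ z → head (filter P? xs) ≡ just z × z ∈ xs × P z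
  head-filter-Any P? (x ∷ xs) any with P? x | any
  ... | yes px | _         = x , refl , here refl , px
  ... | no ¬px | here px   = contradiction px ¬px
  ... | no ¬px | there pxs = let (z , eq , z∈ , pz) = head-filter-Any P? xs pxs in z , eq , there z∈ , pz

  ++-overlap : ∀ (x y x′ y′ : List A) → x ++ y ≡ x′ ++ y′ →
    (∃ λ m → x′ ≡ x ++ m × y ≡ m ++ y′) ⊎ (∃ λ m → x ≡ x′ ++ m × y′ ≡ m ++ y)
  ++-overlap []      y x′       y′ eq = inj₁ (x′ , refl , eq)
  ++-overlap (s ∷ x) y []       y′ eq = inj₂ (s ∷ x , refl , sym eq)
  ++-overlap (s ∷ x) y (s′ ∷ x′) y′ eq with ∷-injective eq
  ... | refl , eq′ with ++-overlap x y x′ y′ eq′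
  ...   | inj₁ (m , x′≡ , y≡) = inj₁ (m , cong (s ∷_) x′≡ , y≡)
  ...   | inj₂ (m , x≡ , y′≡) = inj₂ (m , cong (s ∷_) x≡ , y′≡)

  length-filter-∷ : ∀ {P : Pred A 0ℓ} (P? : Decidable P) x xs →
                    length (filter P? (x ∷ xs)) ≡ (if does (P? x) then 1 else 0) + length (filter P? xs)
  length-filter-∷ P? x xs with does (P? x)
  ... | true  = refl
  ... | false = refl

  ≢[]⇒0<length : ∀ {xs : List A} → xs ≢ [] → 0 < length xs
  ≢[]⇒0<length {[]}    xs≢[] = contradiction refl xs≢[]
  ≢[]⇒0<length {_ ∷ _} _     = s≤s z≤n

  take-length-++ : ∀ (y x : List A) → take (length y) (y ++ x) ≡ y
  take-length-++ []      x = refl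
  take-length-++ (s ∷ y) x = cong (s ∷_) (take-length-++ y x)

  drop-length-++ : ∀ (y x : List A) → drop (length y) (y ++ x) ≡ x
  drop-length-++ []      x = refl
  drop-length-++ (s ∷ y) x = drop-length-++ y x

  length-cartesianProduct : ∀ {B : Set} (xs : List A) (ys : List B) →
                            length (cartesianProduct xs ys) ≡ length xs * length ys
  length-cartesianProduct []       ys = refl
  length-cartesianProduct (x ∷ xs) ys =
    trans (length-++ (map (x ,_) ys)) (cong₂ _+_ (length-map (x ,_) ys) (length-cartesianProduct xs ys))

  drop-≢[] : ∀ j (d : List A) → j < length d → drop j d ≢ []
  drop-≢[] j d j<d eq = <⇒≢ (m<n⇒0<n∸m j<d) (sym (trans (sym (length-drop j d)) (cong length eq)))

module _ {A B : Set} (f : A → Maybe B) where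

  AllJust : List A → Set
  AllJust = All (λ x → ∃ λ d → f x ≡ just d)

  mapMaybe-just-∷ : ∀ {x d} xs → f x ≡ just d → mapMaybe f (x ∷ xs) ≡ d ∷ mapMaybe f xs
  mapMaybe-just-∷ xs eq rewrite eq = refl

  length-mapMaybe-AllJust : ∀ xs → AllJust xs → length (mapMaybe f xs) ≡ length xs
  length-mapMaybe-AllJust []       []              = refl
  length-mapMaybe-AllJust (x ∷ xs) ((_ , eq) ∷ js) rewrite mapMaybe-just-∷ xs eq =
    cong suc (length-mapMaybe-AllJust xs js)

  ∈-mapMaybe⁻ : ∀ xs {d} → d ∈ mapMaybe f xs → ∃ λ x → x ∈ xs × f x ≡ just d
  ∈-mapMaybe⁻ (x ∷ xs) m with f x in eq
  ... | nothing = let (y , y∈ , fy) = ∈-mapMaybe⁻ xs m in y , there y∈ , fy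
  ... | just d with m
  ...   | here refl = x , here refl , eq
  ...   | there m′  = let (y , y∈ , fy) = ∈-mapMaybe⁻ xs m′ in y , there y∈ , fy

  Unique-mapMaybe : ∀ xs → AllJust xs →
                    (∀ {x y d} → x ∈ xs → y ∈ xs → f x ≡ just d → f y ≡ just d → x ≡ y) →
                    Unique xs → Unique (mapMaybe f xs)
  Unique-mapMaybe []       []              _   []          = []
  Unique-mapMaybe (x ∷ xs) ((_ , eq) ∷ js) inj (x≢ ∷ uxs) rewrite mapMaybe-just-∷ xs eq =
    All.tabulate (λ m d≡ → let (y , y∈ , fy) = ∈-mapMaybe⁻ xs m in
                           All.lookup x≢ y∈ (inj (here refl) (there y∈) eq (trans fy (cong just (sym d≡)))))
    ∷ Unique-mapMaybe xs js (λ m m′ → inj (there m) (there m′)) uxs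

  length-filter-mapMaybe : ∀ {P : Pred B 0ℓ} {Q : Pred A 0ℓ} (P? : Decidable P) (Q? : Decidable Q) xs →
    All (λ x → ∃ λ d → f x ≡ just d × (P d → Q x) × (Q x → P d)) xs →
    length (filter P? (mapMaybe f xs)) ≡ length (filter Q? xs)
  length-filter-mapMaybe P? Q? []       []                       = refl
  length-filter-mapMaybe P? Q? (x ∷ xs) ((d , eq , p⇒q , q⇒p) ∷ js)
    rewrite mapMaybe-just-∷ xs eq with P? d | Q? x
  ... | yes _  | yes _  = cong suc (length-filter-mapMaybe P? Q? xs js)
  ... | yes p  | no ¬q  = contradiction (p⇒q p) ¬q
  ... | no ¬p  | yes q  = contradiction (q⇒p q) ¬p
  ... | no _   | no _   = length-filter-mapMaybe P? Q? xs js

m+[n+o]≡n⇒o≡0 : ∀ m n o → m + (n + o) ≡ n → o ≡ 0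
m+[n+o]≡n⇒o≡0 m n o eq = m+n≡0⇒n≡0 m (+-cancelʳ-≡ n (m + o) 0 (trans rearrange eq))
  where
  rearrange : m + o + n ≡ m + (n + o)
  rearrange = trans (+-assoc m o n) (cong (λ k → m + k) (+-comm o n))

b*n≡a*e⇒n≡0∨n≡a : ∀ {a b n e} → Coprime a b → n ≤ a → b * n ≡ a * e → n ≡ 0 ⊎ n ≡ a
b*n≡a*e⇒n≡0∨n≡a {n = zero}          _   _   _   = inj₁ refl
b*n≡a*e⇒n≡0∨n≡a {a} {n = suc _} {e} cop n≤a b*n≡a*e =
  inj₂ (≤-antisym n≤a (∣⇒≤ (coprime-divisor cop (divides e (trans b*n≡a*e (*-comm a e))))))

nCk*k!*[n∸k]!≡n! : ∀ {n k} → k ≤ n → (n C k) * (k ! * (n ∸ k) !) ≡ n !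
nCk*k!*[n∸k]!≡n! {n} {k} k≤n = trans (cong (_* (k ! * (n ∸ k) !)) (nCk≡n!/k![n-k]! k≤n))
  (m/n*n≡m ⦃ m*n≢0 (k !) ((n ∸ k) !) ⦃ k !≢0 ⦄ ⦃ (n ∸ k) !≢0 ⦄ ⦄ (k![n∸k]!∣n! k≤n))

L*n≡nCk⇒L*k!*[n∸k]!≡[n∸1]! : ∀ {L n k} → 0 < n → k ≤ n → L * n ≡ n C k → L * (k ! * (n ∸ k) !) ≡ (n ∸ 1) !
L*n≡nCk⇒L*k!*[n∸k]!≡[n∸1]! {L} {suc m} {k} _ k≤n L*n≡ = *-cancelˡ-≡ (L * X) (m !) (suc m) (begin
  suc m * (L * X)     ≡⟨ rearrange (suc m) L X ⟩
  (L * suc m) * X     ≡⟨ cong (_* X) L*n≡ ⟩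
  (suc m C k) * X     ≡⟨ nCk*k!*[n∸k]!≡n! k≤n ⟩
  suc m * m !         ∎)
  where
  open ≡-Reasoning
  X = k ! * (suc m ∸ k) !
  rearrange : ∀ n L X → n * (L * X) ≡ (L * n) * X
  rearrange = ℕ-Solver.solve-∀

j<i⇒0<i-j : ∀ {i j} → j ℤ.< i → 0ℤ ℤ.< i ℤ.- j
j<i⇒0<i-j {i} {j} j<i = subst (ℤ._< i ℤ.- j) (ℤP.+-inverseʳ j) (ℤP.+-monoˡ-< (- j) j<i)

0<i-j⇒j<i : ∀ {i j} → 0ℤ ℤ.< i ℤ.- j → j ℤ.< i
0<i-j⇒j<i {i} {j} 0<i-j = subst₂ ℤ._<_ (ℤP.+-identityˡ j) (cancel i j) (ℤP.+-monoˡ-< j 0<i-j)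
  where
  cancel : ∀ i j → (i ℤ.- j) ℤ.+ j ≡ i
  cancel = solve-∀

i<i+j⇒0<j : ∀ i j → i ℤ.< i ℤ.+ j → 0ℤ ℤ.< j
i<i+j⇒0<j i j lt = subst (0ℤ ℤ.<_) (cancel i j) (j<i⇒0<i-j lt)
  where
  cancel : ∀ i j → (i ℤ.+ j) ℤ.- i ≡ j
  cancel = solve-∀

-- Lattice paths

endpoint : Point → List Step → Point
endpoint p []      = p
endpoint p (s ∷ w) = endpoint (move s p) w

endpoint-counts : ∀ x y w → endpoint (x , y) w ≡ (x + countE w , y + countN w)
endpoint-counts x y []      = cong₂ _,_ (sym (+-identityʳ x)) (sym (+-identityʳ y))
endpoint-counts x y (N ∷ w) =
  trans (endpoint-counts x (suc y) w) (cong (x + countE w ,_) (sym (+-suc y (countN w))))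
endpoint-counts x y (E ∷ w) =
  trans (endpoint-counts (suc x) y w) (cong (_, y + countN w) (sym (+-suc x (countE w))))

countN-++ : ∀ u v → countN (u ++ v) ≡ countN u + countN v
countN-++ []      v = refl
countN-++ (N ∷ u) v = cong suc (countN-++ u v)
countN-++ (E ∷ u) v = countN-++ u v

countE-++ : ∀ u v → countE (u ++ v) ≡ countE u + countE v
countE-++ []      v = refl
countE-++ (N ∷ u) v = countE-++ u v
countE-++ (E ∷ u) v = cong suc (countE-++ u v)

countN+countE≡length : ∀ w → countN w + countE w ≡ length w
countN+countE≡length []      = refl
countN+countE≡length (N ∷ w) = cong suc (countN+countE≡length w)
countN+countE≡length (E ∷ w) = trans (+-suc (countN w) (countE w)) (cong suc (countN+countE≡length w))

y≤-northBottoms : ∀ x y w {p} → p ∈ northBottoms (x , y) w → y ≤ proj₂ p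
y≤-northBottoms x y (N ∷ w) (here refl) = ≤-refl
y≤-northBottoms x y (N ∷ w) (there m)   = ≤-trans (n≤1+n y) (y≤-northBottoms x (suc y) w m)
y≤-northBottoms x y (E ∷ w) m           = y≤-northBottoms (suc x) y w m

x≤-northBottoms : ∀ x y w {p} → p ∈ northBottoms (x , y) w → x ≤ proj₁ p
x≤-northBottoms x y (N ∷ w) (here refl) = ≤-refl
x≤-northBottoms x y (N ∷ w) (there m)   = x≤-northBottoms x (suc y) w m
x≤-northBottoms x y (E ∷ w) m           = ≤-trans (n≤1+n x) (x≤-northBottoms (suc x) y w m)

x≤-eastLefts : ∀ x y w {p} → p ∈ eastLefts (x , y) w → x ≤ proj₁ p
x≤-eastLefts x y (N ∷ w) m           = x≤-eastLefts x (suc y) w m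
x≤-eastLefts x y (E ∷ w) (here refl) = ≤-refl
x≤-eastLefts x y (E ∷ w) (there m)   = ≤-trans (n≤1+n x) (x≤-eastLefts (suc x) y w m)

Unique-northBottoms : ∀ x y w → Unique (northBottoms (x , y) w)
Unique-northBottoms x y []      = []
Unique-northBottoms x y (N ∷ w) =
  All.tabulate (λ m eq → 1+n≰n (subst (λ q → suc y ≤ proj₂ q) (sym eq) (y≤-northBottoms x (suc y) w m)))
  ∷ Unique-northBottoms x (suc y) w
Unique-northBottoms x y (E ∷ w) = Unique-northBottoms (suc x) y w

eastLefts-x-injective : ∀ x y w {p q} → p ∈ eastLefts (x , y) w → q ∈ eastLefts (x , y) w →
                        proj₁ p ≡ proj₁ q → p ≡ q
eastLefts-x-injective x y (N ∷ w) m          m′          eq = eastLefts-x-injective x (suc y) w m m′ eq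
eastLefts-x-injective x y (E ∷ w) (here refl) (here refl) _ = refl
eastLefts-x-injective x y (E ∷ w) (here refl) (there m′) eq =
  contradiction (x≤-eastLefts (suc x) y w m′) (<-irrefl eq)
eastLefts-x-injective x y (E ∷ w) (there m)  (here refl) eq =
  contradiction (x≤-eastLefts (suc x) y w m) (<-irrefl (sym eq))
eastLefts-x-injective x y (E ∷ w) (there m)  (there m′)  eq = eastLefts-x-injective (suc x) y w m m′ eq

northBottoms⊆start∷interior : ∀ p w {q} → q ∈ northBottoms p w → q ≡ p ⊎ q ∈ interiorPts p w
northBottoms⊆start∷interior p (N ∷ w)     (here refl) = inj₁ refl
northBottoms⊆start∷interior p (N ∷ t ∷ w) (there m)   =
  inj₂ ([ here , there ]′ (northBottoms⊆start∷interior (move N p) (t ∷ w) m))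
northBottoms⊆start∷interior p (E ∷ t ∷ w) m           =
  inj₂ ([ here , there ]′ (northBottoms⊆start∷interior (move E p) (t ∷ w) m))

northBottoms-suffix : ∀ q w {P} → P ∈ northBottoms q w →
  ∃ λ u → eastLefts (move N P) u ⊆ eastLefts q w × endpoint (move N P) u ≡ endpoint q w
northBottoms-suffix q (N ∷ w) (here refl) = w , (λ m → m) , refl
northBottoms-suffix q (N ∷ w) (there m)   = northBottoms-suffix (move N q) w m
northBottoms-suffix q (E ∷ w) m           =
  let (u , sub , end) = northBottoms-suffix (move E q) w m in u , there ∘ sub , end

length-northBottoms : ∀ q w → length (northBottoms q w) ≡ countN w
length-northBottoms q []      = refl
length-northBottoms q (N ∷ w) = cong suc (length-northBottoms _ w)
length-northBottoms q (E ∷ w) = length-northBottoms _ w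

y≤endpoint : ∀ x y u → y ≤ proj₂ (endpoint (x , y) u)
y≤endpoint x y []      = ≤-refl
y≤endpoint x y (N ∷ u) = ≤-trans (n≤1+n y) (y≤endpoint x (suc y) u)
y≤endpoint x y (E ∷ u) = y≤endpoint (suc x) y u

counts≡0⇒[] : ∀ w → countN w ≡ 0 → countE w ≡ 0 → w ≡ []
counts≡0⇒[] []      _  _  = refl
counts≡0⇒[] (N ∷ w) () _
counts≡0⇒[] (E ∷ w) _  ()

columnCount : ℕ → List (ℕ × ℕ) → ℕ
columnCount c ps = length (filter (λ p → proj₁ p ≟ c) ps)

columnCount-∷-here : ∀ x y ps → columnCount x ((x , y) ∷ ps) ≡ suc (columnCount x ps)
columnCount-∷-here x y ps = cong length (filter-accept (λ p → proj₁ p ≟ x) {xs = ps} refl)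

columnCount-∷-other : ∀ {x c} y ps → x ≢ c → columnCount c ((x , y) ∷ ps) ≡ columnCount c ps
columnCount-∷-other {c = c} y ps x≢c = cong length (filter-reject (λ p → proj₁ p ≟ c) {xs = ps} x≢c)

columnCount-northBottoms-left : ∀ x y w → columnCount x (northBottoms (suc x , y) w) ≡ 0
columnCount-northBottoms-left x y w = cong length (filter-none (λ p → proj₁ p ≟ x)
  (All.tabulate (λ m eq → <-irrefl (sym eq) (x≤-northBottoms (suc x) y w m))))

columnCount-N∷≢0 : ∀ x y u → columnCount x (northBottoms (x , y) (N ∷ u)) ≢ 0
columnCount-N∷≢0 x y u eq = 0≢1+n (trans (sym eq) (columnCount-∷-here x y _))

northBottoms-columnCount-injective : ∀ x y u u′ → countE u ≡ countE u′ →
  (∀ c → columnCount c (northBottoms (x , y) u) ≡ columnCount c (northBottoms (x , y) u′)) → u ≡ u′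
northBottoms-columnCount-injective x y []      []       _  _  = refl
northBottoms-columnCount-injective x y []      (N ∷ u′) _  cc =
  contradiction (sym (cc x)) (columnCount-N∷≢0 x y u′)
northBottoms-columnCount-injective x y (N ∷ u) []       _  cc =
  contradiction (cc x) (columnCount-N∷≢0 x y u)
northBottoms-columnCount-injective x y (N ∷ u) (E ∷ u′) _  cc =
  contradiction (trans (cc x) (columnCount-northBottoms-left x y u′)) (columnCount-N∷≢0 x y u)
northBottoms-columnCount-injective x y (E ∷ u) (N ∷ u′) _  cc =
  contradiction (trans (sym (cc x)) (columnCount-northBottoms-left x y u)) (columnCount-N∷≢0 x y u′)
northBottoms-columnCount-injective x y (E ∷ u) (E ∷ u′) ce cc =
  cong (E ∷_) (northBottoms-columnCount-injective (suc x) y u u′ (suc-injective ce) cc)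
northBottoms-columnCount-injective x y (N ∷ u) (N ∷ u′) ce cc =
  cong (N ∷_) (northBottoms-columnCount-injective x (suc y) u u′ ce cc′)
  where
  cc′ : ∀ c → columnCount c (northBottoms (x , suc y) u) ≡ columnCount c (northBottoms (x , suc y) u′)
  cc′ c with x ≟ c
  ... | yes refl = suc-injective
        (trans (sym (columnCount-∷-here x y _)) (trans (cc x) (columnCount-∷-here x y _)))
  ... | no  x≢c  = trans (sym (columnCount-∷-other y _ x≢c)) (trans (cc c) (columnCount-∷-other y _ x≢c))

ProperPrefixes : (List Step → Set) → List Step → Set
ProperPrefixes Q w = ∀ pre suf → w ≡ pre ++ suf → pre ≢ [] → suf ≢ [] → Q pre

All-interiorPts⇒ProperPrefixes : ∀ {Q : Point → Set} p w → All Q (interiorPts p w) →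
                                 ProperPrefixes (Q ∘ endpoint p) w
All-interiorPts⇒ProperPrefixes p w qs [] suf eq pre≢[] _ = contradiction refl pre≢[]
All-interiorPts⇒ProperPrefixes p (s ∷ []) qs (_ ∷ []) [] refl _ suf≢[] = contradiction refl suf≢[]
All-interiorPts⇒ProperPrefixes p (s ∷ t ∷ w) (q ∷ qs) (_ ∷ []) suf refl _ _ = q
All-interiorPts⇒ProperPrefixes p (s ∷ t ∷ w) (q ∷ qs) (_ ∷ pre@(_ ∷ _)) suf refl _ suf≢[] =
  All-interiorPts⇒ProperPrefixes (move s p) (t ∷ w) qs pre suf refl (λ ()) suf≢[]

ProperPrefixes⇒All-interiorPts : ∀ {Q : Point → Set} p w → ProperPrefixes (Q ∘ endpoint p) w →
                                 All Q (interiorPts p w)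
ProperPrefixes⇒All-interiorPts p []          _  = []
ProperPrefixes⇒All-interiorPts p (s ∷ [])    _  = []
ProperPrefixes⇒All-interiorPts p (s ∷ t ∷ w) qs = qs (s ∷ []) (t ∷ w) refl (λ ()) (λ ())
  ∷ ProperPrefixes⇒All-interiorPts (move s p) (t ∷ w)
      (λ pre suf eq _ suf≢[] → qs (s ∷ pre) suf (cong (s ∷_) eq) (λ ()) suf≢[])

-- Lasers

-- a times the abscissa of the laser ℓ(P) at height y.
laserX : ℕ → ℕ → Point → ℕ → ℕ
laserX a b (x0 , y0) y = a * x0 + b * (y ∸ y0)

LaserAvoidsLattice : ℕ → ℕ → Point → Set
LaserAvoidsLattice a b (x0 , y0) = ∀ x y → y0 < y → y ≤ a → a * x ≢ laserX a b (x0 , y0) y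

-- A lattice point (x , y) on ℓ(P) would give a ∣ b (y − y0) with 0 < y − y0 < a.
coprime⇒laserAvoidsLattice : ∀ {a b x0 y0} → Coprime a b → 0 < y0 → LaserAvoidsLattice a b (x0 , y0)
coprime⇒laserAvoidsLattice {a} {b} {x0} {y0} cop 0<y0 x y y0<y y≤a eq =
  <⇒≱ d<a (∣⇒≤ ⦃ ℕ.>-nonZero (m<n⇒0<n∸m y0<y) ⦄ a∣d)
  where
  d = y ∸ y0
  d<a : d < a
  d<a = <-≤-trans (∸-monoʳ-< 0<y0 (<⇒≤ y0<y)) (≤-trans (m∸n≤m y 0) y≤a)
  a∣d : a ∣ d
  a∣d = coprime-divisor cop (∣m+n∣m⇒∣n (divides x (trans (sym eq) (*-comm a x))) (divides x0 (*-comm a x0)))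

laserX-mono : ∀ a b P y → laserX a b P y ≤ laserX a b P (suc y)
laserX-mono a b (x0 , y0) y = +-monoʳ-≤ (a * x0) (*-monoʳ-≤ b (∸-monoˡ-≤ y0 (n≤1+n y)))

-- The path starts left of ℓ(P) and ends right of it, so ℓ(P) crosses one of its east steps;
-- it does so in the interior, as ℓ(P) misses lattice points.
laser-hits-eastLefts : ∀ {a b x0 y0} → LaserAvoidsLattice a b (x0 , y0) → laserX a b (x0 , y0) a < a * b →
  ∀ u {x y} → y0 < y → a * x < laserX a b (x0 , y0) y → endpoint (x , y) u ≡ (b , a) →
  Any (LaserHits a b (x0 , y0)) (eastLefts (x , y) u)
laser-hits-eastLefts avoid top []      y0<y right refl = contradiction top (<-asym right)
laser-hits-eastLefts {a} {b} {x0} {y0} avoid top (N ∷ u) {x} {y} y0<y right end =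
  laser-hits-eastLefts avoid top u (m<n⇒m<1+n y0<y) (<-≤-trans right (laserX-mono a b (x0 , y0) y)) end
laser-hits-eastLefts {a} {b} {x0} {y0} avoid top (E ∷ u) {x} {y} y0<y right end
  with laserX a b (x0 , y0) y <? a * suc x
... | yes left = here (y0<y , right , left)
... | no ¬left = there (laser-hits-eastLefts avoid top u y0<y right′ end)
  where
  y≤a : y ≤ a
  y≤a = subst (y ≤_) (cong proj₂ end) (y≤endpoint (suc x) y u)
  right′ : a * suc x < laserX a b (x0 , y0) y
  right′ = ≤∧≢⇒< (≮⇒≥ ¬left) (avoid (suc x) y y0<y y≤a)

laserX-top : ∀ {a b x0 y0} → y0 ≤ a → StrictlyAbove a b (x0 , y0) → laserX a b (x0 , y0) a < a * b
laserX-top {a} {b} {x0} {y0} y0≤a above = begin-strict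
  a * x0 + b * (a ∸ y0)  <⟨ +-monoˡ-< (b * (a ∸ y0)) above ⟩
  b * y0 + b * (a ∸ y0)  ≡⟨ *-distribˡ-+ b y0 (a ∸ y0) ⟨
  b * (y0 + (a ∸ y0))    ≡⟨ cong (b *_) (m+[n∸m]≡n y0≤a) ⟩
  b * a                  ≡⟨ *-comm b a ⟩
  a * b                  ∎
  where open ≤-Reasoning

-- Rising at least one row higher moves a laser of slope a/b < 1 more than one column further.
laserX-gap : ∀ {a b X k t s} → a < b → t < s → a * k < X + b * t → a * suc k < X + b * s
laserX-gap {a} {b} {X} {k} {t} {s} a<b t<s right = begin-strict
  a * suc k        ≡⟨ *-suc a k ⟩
  a + a * k        <⟨ +-mono-<-≤ a<b (<⇒≤ right) ⟩
  b + (X + b * t)  ≡⟨ solve ⟩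
  X + b * suc t    ≤⟨ +-monoʳ-≤ X (*-monoʳ-≤ b t<s) ⟩
  X + b * s        ∎
  where
  open ≤-Reasoning
  solve : b + (X + b * t) ≡ X + b * suc t
  solve rewrite *-suc b t = trans (sym (+-assoc b X (b * t)))
    (trans (cong (_+ b * t) (+-comm b X)) (+-assoc X b (b * t)))

LaserHits-unique-source : ∀ {a b x0 y0 y0′ E} → a < b →
  LaserHits a b (x0 , y0) E → LaserHits a b (x0 , y0′) E → y0 ≡ y0′
LaserHits-unique-source {y0 = y0} {y0′} a<b (y0<y , right , left) (y0′<y , right′ , left′)
  with <-cmp y0 y0′
... | tri≈ _ eq _ = eq
... | tri< lt _ _ = contradiction left  (<-asym (laserX-gap a<b (∸-monoʳ-< lt (<⇒≤ y0′<y)) right′))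
... | tri> _ _ gt = contradiction left′ (<-asym (laserX-gap a<b (∸-monoʳ-< gt (<⇒≤ y0<y)) right))

-- The diagonal sets F(D)

module _ {a b : ℕ} (0<a : 0 < a) (a<b : a < b) (cop : Coprime a b) where

  private
    nonOrigin? : Decidable (λ (p : Point) → p ≢ (0 , 0))
    nonOrigin? p = ¬? (p ≟P (0 , 0))

  laserSource-above : ∀ {w} → IsDyck a b w → ∀ {P} → P ∈ laserSources w →
                      P ∈ northBottoms (0 , 0) w × StrictlyAbove a b P
  laserSource-above {w} (_ , _ , above) m with ∈-filter⁻ nonOrigin? {xs = northBottoms (0 , 0) w} m
  ... | m′ , P≢0 with northBottoms⊆start∷interior (0 , 0) w m′
  ...   | inj₁ P≡0       = contradiction P≡0 P≢0
  ...   | inj₂ interior = m′ , All.lookup above interior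

  laserSource-hits : ∀ {w} → IsDyck a b w → ∀ {P} → P ∈ laserSources w →
    ∃ λ T → laserStep a b w P ≡ just T × T ∈ eastLefts (0 , 0) w × LaserHits a b P T
  laserSource-hits {w} dy@(#N , #E , _) {x0 , y0} m =
    head-filter-Any (laserHits? a b (x0 , y0)) (eastLefts (0 , 0) w) crosses
    where
    P∈ = proj₁ (laserSource-above dy m)
    above = proj₂ (laserSource-above dy m)
    suffix = northBottoms-suffix (0 , 0) w P∈
    u = proj₁ suffix
    end : endpoint (x0 , suc y0) u ≡ (b , a)
    end = trans (proj₂ (proj₂ suffix)) (trans (endpoint-counts 0 0 w) (cong₂ _,_ #E #N))
    0<y0 : 0 < y0
    0<y0 = n≢0⇒n>0 (λ { refl → n≮0 (subst (a * x0 <_) (*-zeroʳ b) above) })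
    y0<a : y0 < a
    y0<a = subst (suc y0 ≤_) (cong proj₂ end) (y≤endpoint x0 (suc y0) u)
    start : a * x0 < laserX a b (x0 , y0) (suc y0)
    start rewrite m+n∸n≡m 1 y0 | *-identityʳ b = m<m+n (a * x0) (<-trans 0<a a<b)
    crosses : Any (LaserHits a b (x0 , y0)) (eastLefts (0 , 0) w)
    crosses = Any-resp-⊆ (proj₁ (proj₂ suffix))
      (laser-hits-eastLefts (coprime⇒laserAvoidsLattice cop 0<y0) (laserX-top (<⇒≤ y0<a) above)
                            u (n<1+n y0) start end)

  laserSource-e : ∀ {w} → IsDyck a b w → ∀ {P} → P ∈ laserSources w →
    ∃ λ T → T ∈ eastLefts (0 , 0) w × LaserHits a b P T
          × e a b w P ≡ just (suc (proj₁ P) , suc (suc (proj₁ T)))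
  laserSource-e {w} dy {x0 , y0} m with laserSource-hits dy m
  ... | (k , y) , eq , T∈ , hits@(_ , _ , left) = (k , y) , T∈ , hits , e≡
    where
    x0≤k : x0 ≤ k
    x0≤k = ≤-pred (*-cancelˡ-< a x0 (suc k) (≤-<-trans (m≤m+n (a * x0) _) left))
    e≡ : e a b w (x0 , y0) ≡ just (suc x0 , suc (suc k))
    e≡ rewrite eq = cong just (cong₂ _,_ (m≤n⇒m⊓n≡m x0<2+k) (m≤n⇒m⊔n≡n x0<2+k))
      where x0<2+k = s≤s (m≤n⇒m≤1+n x0≤k)

  e-injective : ∀ {w} → IsDyck a b w → ∀ {P P′} → P ∈ laserSources w → P′ ∈ laserSources w →
                e a b w P ≡ e a b w P′ → P ≡ P′
  e-injective {w} dy {x0 , y0} m m′ eq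
    with laserSource-e dy m | laserSource-e dy m′
  ... | T , T∈ , hits , e≡ | T′ , T′∈ , hits′ , e≡′
    with just-injective (trans (sym e≡) (trans eq e≡′))
  ... | refl with eastLefts-x-injective 0 0 w T∈ T′∈ refl
  ... | refl = cong (x0 ,_) (LaserHits-unique-source a<b hits hits′)

  AllJust-e : ∀ {w} → IsDyck a b w → AllJust (e a b w) (laserSources w)
  AllJust-e dy = All.tabulate (λ m → _ , proj₂ (proj₂ (proj₂ (laserSource-e dy m))))

  Unique-F : ∀ {w} → IsDyck a b w → Unique (F a b w)
  Unique-F {w} dy = Unique-mapMaybe (e a b w) (laserSources w) (AllJust-e dy)
    (λ m m′ eq eq′ → e-injective dy m m′ (trans eq (sym eq′)))
    (Unique.filter⁺ nonOrigin? (Unique-northBottoms 0 0 w))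

  Dyck-starts-N : ∀ {w} → IsDyck a b w → ∃ λ u → w ≡ N ∷ u
  Dyck-starts-N {[]}        (#N , _)            = contradiction #N (<⇒≢ 0<a)
  Dyck-starts-N {N ∷ u}     _                   = u , refl
  Dyck-starts-N {E ∷ []}    (#N , _)            = contradiction #N (<⇒≢ 0<a)
  Dyck-starts-N {E ∷ _ ∷ _} (_ , _ , above ∷ _) = contradiction (subst (a * 1 <_) (*-zeroʳ b) above) n≮0

  laserSources-N∷ : ∀ u → laserSources (N ∷ u) ≡ northBottoms (0 , 1) u
  laserSources-N∷ u = trans (filter-reject nonOrigin? {xs = northBottoms (0 , 1) u} (λ P≢0 → P≢0 refl))
    (filter-all nonOrigin? (All.tabulate (λ m eq → <-irrefl refl
      (subst (λ q → 1 ≤ proj₂ q) eq (y≤-northBottoms 0 1 u m)))))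

  length-F : ∀ {w} → IsDyck a b w → length (F a b w) ≡ a ∸ 1
  length-F {w} dy with Dyck-starts-N dy
  length-F {w} dy@(#N , _) | u , refl = begin
    length (F a b w)                   ≡⟨ length-mapMaybe-AllJust (e a b w) (laserSources w) (AllJust-e dy) ⟩
    length (laserSources w)            ≡⟨ cong length (laserSources-N∷ u) ⟩
    length (northBottoms (0 , 1) u)    ≡⟨ length-northBottoms (0 , 1) u ⟩
    countN u                           ≡⟨ cong (_∸ 1) #N ⟩
    a ∸ 1                              ∎
    where open ≡-Reasoning

  card-F : ∀ {w} → IsDyck a b w → card (F a b w) ≡ a ∸ 1
  card-F {w} dy = trans (cong length (deduplicate-AllPairs _≟P_ (F a b w) (Unique-F dy))) (length-F dy)

  columnCount-F : ∀ {w} → IsDyck a b w → ∀ c →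
                  columnCount (suc c) (F a b w) ≡ columnCount c (laserSources w)
  columnCount-F {w} dy c = length-filter-mapMaybe (e a b w) (λ d → proj₁ d ≟ suc c) (λ P → proj₁ P ≟ c)
    (laserSources w)
    (All.tabulate (λ m → _ , proj₂ (proj₂ (proj₂ (laserSource-e dy m))) , suc-injective , cong suc))

  F-injective : ∀ {w w′} → IsDyck a b w → IsDyck a b w′ → F a b w ⊆ F a b w′ → w ≡ w′
  F-injective {w} {w′} dy dy′ F⊆F′ with Dyck-starts-N dy | Dyck-starts-N dy′
  ... | u , refl | u′ , refl = cong (N ∷_) (northBottoms-columnCount-injective 0 1 u u′ #E≡ columns≡)
    where
    F′⊆F : F a b w′ ⊆ F a b w
    F′⊆F = Unique-⊆-length≥⇒⊇ _≟P_ (Unique-F dy) F⊆F′ (≤-reflexive (trans (length-F dy′) (sym (length-F dy))))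
    #E≡ : countE u ≡ countE u′
    #E≡ = trans (proj₁ (proj₂ dy)) (sym (proj₁ (proj₂ dy′)))
    columns≡ : ∀ c → columnCount c (northBottoms (0 , 1) u) ≡ columnCount c (northBottoms (0 , 1) u′)
    columns≡ c = begin
      columnCount c (northBottoms (0 , 1) u)   ≡⟨ cong (columnCount c) (laserSources-N∷ u) ⟨
      columnCount c (laserSources w)           ≡⟨ columnCount-F dy c ⟨
      columnCount (suc c) (F a b w)            ≡⟨ Unique-⊆-⊇⇒length≡ (Unique.filter⁺ column? (Unique-F dy))
                                                    (Unique.filter⁺ column? (Unique-F dy′))
                                                    (filter⁺′ column? column? id F⊆F′)
                                                    (filter⁺′ column? column? id F′⊆F) ⟩
      columnCount (suc c) (F a b w′)           ≡⟨ columnCount-F dy′ c ⟩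
      columnCount c (laserSources w′)          ≡⟨ cong (columnCount c) (laserSources-N∷ u′) ⟩
      columnCount c (northBottoms (0 , 1) u′)  ∎
      where
      open ≡-Reasoning
      column? = λ (d : Diagonal) → proj₁ d ≟ suc c

extend : List Step → List (List Step)
extend w = (N ∷ w) ∷ (E ∷ w) ∷ []

Unique-words : ∀ n → Unique (words n)
Unique-words zero    = [] ∷ []
Unique-words (suc n) = Unique.concat⁺ (map⁺ (All.universal (λ _ → ((λ ()) ∷ []) ∷ [] ∷ []) (words n)))
  (AllPairs-map-∈ extend (λ _ _ → disjoint) (Unique-words n))
  where
  disjoint : ∀ {w w′} → w ≢ w′ → Disjoint (extend w) (extend w′)
  disjoint w≢w′ (here refl         , here refl)         = w≢w′ refl
  disjoint w≢w′ (there (here refl) , there (here refl)) = w≢w′ refl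
  disjoint w≢w′ (here refl         , there (here ()))
  disjoint w≢w′ (there (here refl) , here ())

∈-words⇒length : ∀ n {w} → w ∈ words n → length w ≡ n
∈-words⇒length zero    (here refl) = refl
∈-words⇒length (suc n) m with find (∈-concatMap⁻ extend {xs = words n} m)
... | w , w∈ , here refl         = cong suc (∈-words⇒length n w∈)
... | w , w∈ , there (here refl) = cong suc (∈-words⇒length n w∈)

∈-words : ∀ w → w ∈ words (length w)
∈-words []      = here refl
∈-words (s ∷ w) = ∈-concatMap⁺ extend (lose (∈-words w) (∈-extend s))
  where
  ∈-extend : ∀ s → s ∷ w ∈ extend w
  ∈-extend N = here refl
  ∈-extend E = there (here refl)

withNorth : ℕ → List (List Step) → List (List Step)
withNorth k = filter (λ w → countN w ≟ k)

length-withNorth-extend-zero : ∀ ws → length (withNorth 0 (concatMap extend ws)) ≡ length (withNorth 0 ws)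
length-withNorth-extend-zero []       = refl
length-withNorth-extend-zero (w ∷ ws) =
  trans (length-filter-∷ (λ v → countN v ≟ 0) (E ∷ w) (concatMap extend ws))
    (trans (cong (λ l → (if does (countN w ≟ 0) then 1 else 0) + l) (length-withNorth-extend-zero ws))
      (sym (length-filter-∷ (λ v → countN v ≟ 0) w ws)))

-- does (suc m ≟ suc n) reduces to does (m ≟ n), so N ∷ w is counted exactly when w is.
length-withNorth-extend-suc : ∀ k ws → length (withNorth (suc k) (concatMap extend ws))
                                       ≡ length (withNorth k ws) + length (withNorth (suc k) ws)
length-withNorth-extend-suc k []       = refl
length-withNorth-extend-suc k (w ∷ ws) = begin
  length (withNorth (suc k) (extend w ++ concatMap extend ws))
    ≡⟨ length-filter-∷ north+1? (N ∷ w) _ ⟩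
  δₖ + length (withNorth (suc k) ((E ∷ w) ∷ concatMap extend ws))
    ≡⟨ cong (λ l → δₖ + l) (length-filter-∷ north+1? (E ∷ w) _) ⟩
  δₖ + (δₖ₊₁ + length (withNorth (suc k) (concatMap extend ws)))
    ≡⟨ cong (λ l → δₖ + (δₖ₊₁ + l)) (length-withNorth-extend-suc k ws) ⟩
  δₖ + (δₖ₊₁ + (length (withNorth k ws) + length (withNorth (suc k) ws)))
    ≡⟨ interchange δₖ δₖ₊₁ _ _ ⟩
  (δₖ + length (withNorth k ws)) + (δₖ₊₁ + length (withNorth (suc k) ws))
    ≡⟨ cong₂ _+_ (length-filter-∷ north? w ws) (length-filter-∷ north+1? w ws) ⟨
  length (withNorth k (w ∷ ws)) + length (withNorth (suc k) (w ∷ ws))  ∎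
  where
  open ≡-Reasoning
  north? = λ v → countN v ≟ k
  north+1? = λ v → countN v ≟ suc k
  δₖ = (if does (countN w ≟ k) then 1 else 0)
  δₖ₊₁ = (if does (countN w ≟ suc k) then 1 else 0)
  interchange : ∀ p q r s → p + (q + (r + s)) ≡ (p + r) + (q + s)
  interchange = ℕ-Solver.solve-∀

length-withNorth-words : ∀ n k → length (withNorth k (words n)) ≡ n C k
length-withNorth-words zero    zero    = refl
length-withNorth-words zero    (suc k) = refl
length-withNorth-words (suc n) zero    =
  trans (length-withNorth-extend-zero (words n)) (length-withNorth-words n zero)
length-withNorth-words (suc n) (suc k) =
  trans (length-withNorth-extend-suc k (words n))
    (trans (cong₂ _+_ (length-withNorth-words n k) (length-withNorth-words n (suc k)))
      (nCk+nC[k+1]≡[n+1]C[k+1] n k))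

-- The cycle lemma

module CycleLemma (a b : ℕ) where

  stepWeight : Step → ℤ
  stepWeight N = + b
  stepWeight E = - + a

  -- b · #N − a · #E, positive exactly when the endpoint lies strictly above y = (a/b) x.
  weight : List Step → ℤ
  weight []      = 0ℤ
  weight (s ∷ w) = stepWeight s ℤ.+ weight w

  weight-++ : ∀ u v → weight (u ++ v) ≡ weight u ℤ.+ weight v
  weight-++ []      v = sym (ℤP.+-identityˡ (weight v))
  weight-++ (s ∷ u) v = trans (cong (λ i → stepWeight s ℤ.+ i) (weight-++ u v))
                              (sym (ℤP.+-assoc (stepWeight s) (weight u) (weight v)))

  weight-counts : ∀ u → weight u ≡ + (b * countN u) ℤ.- + (a * countE u)
  weight-counts []      rewrite *-zeroʳ a | *-zeroʳ b = refl
  weight-counts (N ∷ u) rewrite weight-counts u | *-suc b (countN u) | ℤP.pos-+ b (b * countN u) =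
    shift (+ b) (+ (b * countN u)) (+ (a * countE u))
    where
    shift : ∀ i j k → i ℤ.+ (j ℤ.- k) ≡ (i ℤ.+ j) ℤ.- k
    shift = solve-∀
  weight-counts (E ∷ u) rewrite weight-counts u | *-suc a (countE u) | ℤP.pos-+ a (a * countE u) =
    shift (+ a) (+ (b * countN u)) (+ (a * countE u))
    where
    shift : ∀ i j k → - i ℤ.+ (j ℤ.- k) ≡ j ℤ.- (i ℤ.+ k)
    shift = solve-∀

  above⇒0<weight : ∀ u → a * countE u < b * countN u → 0ℤ ℤ.< weight u
  above⇒0<weight u above = subst (0ℤ ℤ.<_) (sym (weight-counts u)) (j<i⇒0<i-j (+<+ above))

  0<weight⇒above : ∀ u → 0ℤ ℤ.< weight u → a * countE u < b * countN u
  0<weight⇒above u pos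
    with 0<i-j⇒j<i {+ (b * countN u)} {+ (a * countE u)} (subst (0ℤ ℤ.<_) (weight-counts u) pos)
  ... | +<+ above = above

  weight≡0⇒balanced : ∀ u → weight u ≡ 0ℤ → b * countN u ≡ a * countE u
  weight≡0⇒balanced u w0 = ℤP.+-injective (ℤP.i-j≡0⇒i≡j _ _ (trans (sym (weight-counts u)) w0))

  weight-full : ∀ w → countN w ≡ a → countE w ≡ b → weight w ≡ 0ℤ
  weight-full w #N #E rewrite weight-counts w | #N | #E | *-comm a b = ℤP.+-inverseʳ (+ (b * a))

  PrefixPositive : List Step → Set
  PrefixPositive = ProperPrefixes (λ pre → 0ℤ ℤ.< weight pre)

  Dyck⇒PrefixPositive : ∀ {w} → IsDyck a b w → PrefixPositive w
  Dyck⇒PrefixPositive {w} (_ , _ , above) pre suf eq pre≢[] suf≢[] =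
    above⇒0<weight pre (subst (StrictlyAbove a b) (endpoint-counts 0 0 pre)
      (All-interiorPts⇒ProperPrefixes (0 , 0) w above pre suf eq pre≢[] suf≢[]))

  PrefixPositive⇒Dyck : ∀ {w} → countN w ≡ a → countE w ≡ b → PrefixPositive w → IsDyck a b w
  PrefixPositive⇒Dyck {w} #N #E pos = #N , #E , ProperPrefixes⇒All-interiorPts (0 , 0) w
    (λ pre suf eq pre≢[] suf≢[] → subst (StrictlyAbove a b) (sym (endpoint-counts 0 0 pre))
      (0<weight⇒above pre (pos pre suf eq pre≢[] suf≢[])))

  -- Weight 0 means b · #N = a · #E, so by coprimality the factor has no or all north steps.
  factor-weight≢0 : Coprime a b → 0 < a → ∀ {w} p m s → w ≡ p ++ m ++ s →
    countN w ≡ a → countE w ≡ b → m ≢ [] → s ≢ [] → weight m ≢ 0ℤ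
  factor-weight≢0 cop 0<a p m s refl #N #E m≢[] s≢[] w0 =
    [ (λ #Nm≡0 → m≢[] (counts≡0⇒[] m #Nm≡0 (#Em≡0 #Nm≡0)))
    , (λ #Nm≡a → s≢[] (counts≡0⇒[] s (#Ns≡0 #Nm≡a) (#Es≡0 #Nm≡a)))
    ]′ (b*n≡a*e⇒n≡0∨n≡a cop #Nm≤a balanced)
    where
    instance
      a≢0 : NonZero a
      a≢0 = ℕ.>-nonZero 0<a
    balanced = weight≡0⇒balanced m w0
    #N′ : countN p + (countN m + countN s) ≡ a
    #N′ = trans (cong (λ n → countN p + n) (sym (countN-++ m s))) (trans (sym (countN-++ p (m ++ s))) #N)
    #Nm≤a : countN m ≤ a
    #Nm≤a = subst (countN m ≤_) #N′ (≤-trans (m≤m+n _ (countN s)) (m≤n+m _ (countN p)))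
    #E′ : countE p + (countE m + countE s) ≡ b
    #E′ = trans (cong (λ n → countE p + n) (sym (countE-++ m s))) (trans (sym (countE-++ p (m ++ s))) #E)
    #Em≡0 : countN m ≡ 0 → countE m ≡ 0
    #Em≡0 #Nm≡0 = m*n≡0⇒m≡0 (countE m) a
      (trans (*-comm (countE m) a) (trans (sym balanced) (trans (cong (b *_) #Nm≡0) (*-zeroʳ b))))
    #Em≡b : countN m ≡ a → countE m ≡ b
    #Em≡b #Nm≡a = *-cancelˡ-≡ (countE m) b a
      (sym (trans (*-comm a b) (trans (cong (b *_) (sym #Nm≡a)) balanced)))
    #Ns≡0 : countN m ≡ a → countN s ≡ 0
    #Ns≡0 #Nm≡a = m+[n+o]≡n⇒o≡0 (countN p) a (countN s)
      (subst (λ n → countN p + (n + countN s) ≡ a) #Nm≡a #N′)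
    #Es≡0 : countN m ≡ a → countE s ≡ 0
    #Es≡0 #Nm≡a = m+[n+o]≡n⇒o≡0 (countE p) b (countE s)
      (subst (λ n → countE p + (n + countE s) ≡ b) (#Em≡b #Nm≡a) #E′)

  ¬rotation-overlap : ∀ x m y → x ≢ [] → m ≢ [] → weight (x ++ m ++ y) ≡ 0ℤ →
    PrefixPositive ((m ++ y) ++ x) → PrefixPositive (y ++ x ++ m) → ⊥
  ¬rotation-overlap x m y x≢[] m≢[] w0 pos pos′ = ℤP.<-irrefl (sym w0′) (ℤP.+-mono-< 0<m 0<yx)
    where
    0<m : 0ℤ ℤ.< weight m
    0<m = pos m (y ++ x) (++-assoc m y x) m≢[] (x≢[] ∘ ++-conicalʳ y x)
    0<yx : 0ℤ ℤ.< weight (y ++ x)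
    0<yx = pos′ (y ++ x) m (sym (++-assoc y x m)) (x≢[] ∘ ++-conicalʳ y x) m≢[]
    rotate : ∀ i j k → i ℤ.+ (j ℤ.+ k) ≡ j ℤ.+ (k ℤ.+ i)
    rotate = solve-∀
    w0′ : weight m ℤ.+ weight (y ++ x) ≡ 0ℤ
    w0′ = begin
      weight m ℤ.+ weight (y ++ x)                ≡⟨ cong (λ i → weight m ℤ.+ i) (weight-++ y x) ⟩
      weight m ℤ.+ (weight y ℤ.+ weight x)        ≡⟨ rotate (weight x) (weight m) (weight y) ⟨
      weight x ℤ.+ (weight m ℤ.+ weight y)        ≡⟨ cong (λ i → weight x ℤ.+ i) (weight-++ m y) ⟨
      weight x ℤ.+ weight (m ++ y)                ≡⟨ weight-++ x (m ++ y) ⟨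
      weight (x ++ m ++ y)                        ≡⟨ w0 ⟩
      0ℤ                                          ∎
      where open ≡-Reasoning

  rotation-unique : ∀ x y x′ y′ → x ++ y ≡ x′ ++ y′ → weight (x ++ y) ≡ 0ℤ → x ≢ [] → x′ ≢ [] →
    PrefixPositive (y ++ x) → PrefixPositive (y′ ++ x′) → x ≡ x′
  rotation-unique x y x′ y′ eq w0 x≢[] x′≢[] pos pos′ with ++-overlap x y x′ y′ eq
  ... | inj₁ ([]         , x′≡ , _)    = sym (trans x′≡ (++-identityʳ x))
  ... | inj₁ (m@(_ ∷ _) , refl , refl) = ⊥-elim (¬rotation-overlap x m y′ x≢[] (λ ()) w0 pos pos′)
  ... | inj₂ ([]         , x≡ , _)     = trans x≡ (++-identityʳ x′)
  ... | inj₂ (m@(_ ∷ _) , refl , refl) =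
    ⊥-elim (¬rotation-overlap x′ m y x′≢[] (λ ()) (trans (cong weight (sym eq)) w0) pos′ pos)

  MinimalPrefix : List Step → List Step → Set
  MinimalPrefix w x = ∀ x′ y′ → w ≡ x′ ++ y′ → y′ ≢ [] → weight x ℤ.≤ weight x′

  minimalPrefix : ∀ w → w ≢ [] → ∃ λ x → ∃ λ y → w ≡ x ++ y × y ≢ [] × MinimalPrefix w x
  minimalPrefix []          w≢[] = contradiction refl w≢[]
  minimalPrefix (s ∷ [])    _    = [] , s ∷ [] , refl , (λ ()) , min
    where
    min : MinimalPrefix (s ∷ []) []
    min []       y′ _  _     = ℤP.≤-refl
    min (_ ∷ x′) y′ eq y′≢[] = contradiction (++-conicalʳ x′ y′ (sym (proj₂ (∷-injective eq)))) y′≢[]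
  minimalPrefix (s ∷ t ∷ w) _ with minimalPrefix (t ∷ w) (λ ())
  ... | x , y , eq , y≢[] , min with weight (s ∷ x) ℤP.≤? 0ℤ
  ...   | yes s∷x≤0 = s ∷ x , y , cong (s ∷_) eq , y≢[] , min′
    where
    min′ : MinimalPrefix (s ∷ t ∷ w) (s ∷ x)
    min′ []       _  _   _     = s∷x≤0
    min′ (_ ∷ x′) y′ eq′ y′≢[] with ∷-injective eq′
    ... | refl , eq″ = ℤP.+-monoʳ-≤ (stepWeight s) (min x′ y′ eq″ y′≢[])
  ...   | no  s∷x≰0 = [] , s ∷ t ∷ w , refl , (λ ()) , min′
    where
    min′ : MinimalPrefix (s ∷ t ∷ w) []
    min′ []       _  _   _     = ℤP.≤-refl
    min′ (_ ∷ x′) y′ eq′ y′≢[] with ∷-injective eq′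
    ... | refl , eq″ =
      ℤP.<⇒≤ (ℤP.<-≤-trans (ℤP.≰⇒> s∷x≰0) (ℤP.+-monoʳ-≤ (stepWeight s) (min x′ y′ eq″ y′≢[])))

  minimalPrefix-strict : Coprime a b → 0 < a → ∀ {w x y} → countN w ≡ a → countE w ≡ b →
    w ≡ x ++ y → y ≢ [] → MinimalPrefix w x →
    ∀ x′ y′ → w ≡ x′ ++ y′ → y′ ≢ [] → x′ ≢ x → weight x ℤ.< weight x′
  minimalPrefix-strict cop 0<a {w} {x} {y} #N #E w≡ y≢[] min x′ y′ w≡′ y′≢[] x′≢x =
    ℤP.≤∧≢⇒< (min x′ y′ w≡′ y′≢[]) weights≢
    where
    weights≢ : weight x ≢ weight x′
    weights≢ eq with ++-overlap x y x′ y′ (trans (sym w≡) w≡′)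
    ... | inj₁ ([]         , x′≡ , _) = x′≢x (trans x′≡ (++-identityʳ x))
    ... | inj₁ (m@(_ ∷ _) , refl , refl) =
      factor-weight≢0 cop 0<a x m y′ (trans w≡′ (++-assoc x m y′)) #N #E (λ ()) y′≢[]
        (identityʳ-unique (weight x) (weight m) (trans (sym (weight-++ x m)) (sym eq)))
    ... | inj₂ ([]         , x≡ , _) = x′≢x (sym (trans x≡ (++-identityʳ x′)))
    ... | inj₂ (m@(_ ∷ _) , refl , refl) =
      factor-weight≢0 cop 0<a x′ m y (trans w≡ (++-assoc x′ m y)) #N #E (λ ()) y≢[]
        (identityʳ-unique (weight x′) (weight m) (trans (sym (weight-++ x′ m)) eq))

  rotation-at-minimalPrefix : Coprime a b → 0 < a → ∀ {w} x y → countN w ≡ a → countE w ≡ b →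
    w ≡ x ++ y → y ≢ [] → MinimalPrefix w x → PrefixPositive (y ++ x)
  rotation-at-minimalPrefix cop 0<a {w} x y #N #E w≡ y≢[] min = positive
    where
    below : ∀ x′ y′ → w ≡ x′ ++ y′ → y′ ≢ [] → x′ ≢ x → weight x ℤ.< weight x′
    below = minimalPrefix-strict cop 0<a #N #E w≡ y≢[] min

    balance : weight x ℤ.+ weight y ≡ 0ℤ
    balance = trans (sym (weight-++ x y)) (trans (cong weight (sym w≡)) (weight-full w #N #E))

    positive-after-y : ∀ m s → x ≡ m ++ s → s ≢ [] → 0ℤ ℤ.< weight (y ++ m)
    positive-after-y m s x≡ s≢[] = begin-strict
      0ℤ                       ≡⟨ balance ⟨
      weight x ℤ.+ weight y    <⟨ ℤP.+-monoˡ-< (weight y) x<m ⟩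
      weight m ℤ.+ weight y    ≡⟨ ℤP.+-comm (weight m) (weight y) ⟩
      weight y ℤ.+ weight m    ≡⟨ weight-++ y m ⟨
      weight (y ++ m)          ∎
      where
      open ℤP.≤-Reasoning
      x<m : weight x ℤ.< weight m
      x<m = below m (s ++ y) (trans w≡ (trans (cong (_++ y) x≡) (++-assoc m s y))) (y≢[] ∘ ++-conicalʳ s y)
              (λ m≡x → s≢[] (++-identityʳ-unique m (trans m≡x x≡)))

    positive : PrefixPositive (y ++ x)
    positive pre suf eq pre≢[] suf≢[] with ++-overlap y x pre suf eq
    ... | inj₁ (m , refl , x≡) = positive-after-y m suf x≡ suf≢[]
    ... | inj₂ ([] , y≡ , refl) =
      subst (λ p → 0ℤ ℤ.< weight p) (trans (++-identityʳ y) (trans y≡ (++-identityʳ pre)))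
        (positive-after-y [] x refl suf≢[])
    ... | inj₂ (m@(_ ∷ _) , refl , refl) =
      i<i+j⇒0<j (weight x) (weight pre) (subst (weight x ℤ.<_) (weight-++ x pre)
        (below (x ++ pre) m (trans w≡ (sym (++-assoc x pre m))) (λ ())
          (pre≢[] ∘ ++-identityʳ-unique x ∘ sym)))

  prefixPositive-rotation : Coprime a b → 0 < a → ∀ w → w ≢ [] → countN w ≡ a → countE w ≡ b →
    ∃ λ x → ∃ λ y → w ≡ x ++ y × x ≢ [] × PrefixPositive (y ++ x)
  prefixPositive-rotation cop 0<a w w≢[] #N #E with minimalPrefix w w≢[]
  ... | [] , y , refl , y≢[] , min =
    y , [] , sym (++-identityʳ y) , w≢[] ,
    subst PrefixPositive (++-identityʳ y) (rotation-at-minimalPrefix cop 0<a [] y #N #E refl y≢[] min)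
  ... | x@(_ ∷ _) , y , w≡ , y≢[] , min =
    x , y , w≡ , (λ ()) , rotation-at-minimalPrefix cop 0<a x y #N #E w≡ y≢[] min

-- Counting Dyck paths

rotate : List Step × ℕ → List Step
rotate (d , j) = drop j d ++ take j d

swap-hom : (f : List Step → ℕ) → (∀ u v → f (u ++ v) ≡ f u + f v) → ∀ u v → f (u ++ v) ≡ f (v ++ u)
swap-hom f hom u v = trans (hom u v) (trans (+-comm (f u) (f v)) (sym (hom v u)))

rotate-hom : (f : List Step → ℕ) → (∀ u v → f (u ++ v) ≡ f u + f v) → ∀ d j → f (rotate (d , j)) ≡ f d
rotate-hom f hom d j = trans (swap-hom f hom (drop j d) (take j d)) (cong f (take++drop≡id j d))

module _ {a b : ℕ} (0<a : 0 < a) (cop : Coprime a b) where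

  open CycleLemma a b

  private
    n = a + b
    D = dyckPaths a b
    splits = cartesianProduct D (upTo n)

  ∈-dyckPaths⁻ : ∀ {d} → d ∈ D → IsDyck a b d × length d ≡ n
  ∈-dyckPaths⁻ m = let (m′ , dy) = ∈-filter⁻ (isDyck? a b) {xs = words n} m in dy , ∈-words⇒length n m′

  ∈-dyckPaths⁺ : ∀ {d} → IsDyck a b d → d ∈ D
  ∈-dyckPaths⁺ {d} dy@(#N , #E , _) =
    ∈-filter⁺ (isDyck? a b) (subst (λ l → d ∈ words l) length≡ (∈-words d)) dy
    where
    length≡ : length d ≡ n
    length≡ = trans (sym (countN+countE≡length d)) (cong₂ _+_ #N #E)

  ∈-splits⁻ : ∀ {d j} → (d , j) ∈ splits → IsDyck a b d × j < length d
  ∈-splits⁻ {d} m with ∈-cartesianProduct⁻ D (upTo n) m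
  ... | d∈ , j∈ = let (dy , len) = ∈-dyckPaths⁻ d∈ in dy , subst (_ <_) (sym len) (∈-upTo⁻ j∈)

  rotate-injective : ∀ {d j d′ j′} → IsDyck a b d → IsDyck a b d′ → j < length d → j′ < length d′ →
                     rotate (d , j) ≡ rotate (d′ , j′) → (d , j) ≡ (d′ , j′)
  rotate-injective {d} {j} {d′} {j′} dy dy′ j<d j′<d′ eq = cong₂ _,_ d≡ j≡
    where
    prefixPositive : ∀ {d} j → IsDyck a b d → PrefixPositive (take j d ++ drop j d)
    prefixPositive {d} j dy = subst PrefixPositive (sym (take++drop≡id j d)) (Dyck⇒PrefixPositive dy)
    weight≡0 : weight (rotate (d , j)) ≡ 0ℤ
    weight≡0 = weight-full (rotate (d , j)) (trans (rotate-hom countN countN-++ d j) (proj₁ dy))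
                                             (trans (rotate-hom countE countE-++ d j) (proj₁ (proj₂ dy)))
    drop≡ : drop j d ≡ drop j′ d′
    drop≡ = rotation-unique (drop j d) (take j d) (drop j′ d′) (take j′ d′) eq weight≡0
              (drop-≢[] j d j<d) (drop-≢[] j′ d′ j′<d′) (prefixPositive j dy) (prefixPositive j′ dy′)
    take≡ : take j d ≡ take j′ d′
    take≡ = ++-cancelˡ (drop j d) (take j d) (take j′ d′) (trans eq (cong (_++ take j′ d′) (sym drop≡)))
    d≡ : d ≡ d′
    d≡ = trans (sym (take++drop≡id j d)) (trans (cong₂ _++_ take≡ drop≡) (take++drop≡id j′ d′))
    length-take≡ : ∀ {j} (d : List Step) → j < length d → length (take j d) ≡ j
    length-take≡ {j} d j<d = trans (length-take j d) (m≤n⇒m⊓n≡m (<⇒≤ j<d))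
    j≡ : j ≡ j′
    j≡ = trans (sym (length-take≡ d j<d)) (trans (cong length take≡) (length-take≡ d′ j′<d′))

  Unique-rotations : Unique (map rotate splits)
  Unique-rotations = AllPairs-map-∈ rotate injective
    (Unique.cartesianProduct⁺ (Unique.filter⁺ (isDyck? a b) (Unique-words n)) (Unique.upTo⁺ n))
    where
    injective : ∀ {p q} → p ∈ splits → q ∈ splits → p ≢ q → rotate p ≢ rotate q
    injective {d , j} {d′ , j′} p∈ q∈ p≢q eq =
      let (dy , j<d) = ∈-splits⁻ p∈ ; (dy′ , j′<d′) = ∈-splits⁻ q∈
      in p≢q (rotate-injective dy dy′ j<d j′<d′ eq)

  rotations⊆withNorth : map rotate splits ⊆ withNorth a (words n)
  rotations⊆withNorth m with ∈-map⁻ rotate m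
  ... | (d , j) , p∈ , refl =
    ∈-filter⁺ (λ w → countN w ≟ a) (subst (λ l → rotate (d , j) ∈ words l) length≡ (∈-words _))
      (trans (rotate-hom countN countN-++ d j) (proj₁ (proj₁ (∈-dyckPaths⁻ d∈))))
    where
    d∈ = proj₁ (∈-cartesianProduct⁻ D (upTo n) p∈)
    length≡ : length (rotate (d , j)) ≡ n
    length≡ = trans (rotate-hom length (λ u v → length-++ u) d j) (proj₂ (∈-dyckPaths⁻ d∈))

  ∈-withNorth⁻ : ∀ {w} → w ∈ withNorth a (words n) → countN w ≡ a × countE w ≡ b × length w ≡ n
  ∈-withNorth⁻ {w} m with ∈-filter⁻ (λ w → countN w ≟ a) {xs = words n} m
  ... | w∈ , #N = #N , #E , len
    where
    len = ∈-words⇒length n w∈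
    #E : countE w ≡ b
    #E = +-cancelˡ-≡ a (countE w) b (trans (cong (_+ countE w) (sym #N)) (trans (countN+countE≡length w) len))

  withNorth⊆rotations : withNorth a (words n) ⊆ map rotate splits
  withNorth⊆rotations {w} m with ∈-withNorth⁻ m
  ... | #N , #E , len with prefixPositive-rotation cop 0<a w w≢[] #N #E
    where
    w≢[] : w ≢ []
    w≢[] refl = <⇒≢ (<-≤-trans 0<a (m≤m+n a b)) len
  ... | x , y , refl , x≢[] , pos =
    subst (_∈ map rotate splits) rotate≡
      (∈-map⁺ rotate (∈-cartesianProduct⁺ (∈-dyckPaths⁺ dy) (∈-upTo⁺ y<n)))
    where
    dy : IsDyck a b (y ++ x)
    dy = PrefixPositive⇒Dyck (trans (swap-hom countN countN-++ y x) #N)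
                             (trans (swap-hom countE countE-++ y x) #E) pos
    y<n : length y < n
    y<n = subst (length y <_) (trans (sym (length-++ x)) len) (m<n+m (length y) (≢[]⇒0<length x≢[]))
    rotate≡ : rotate (y ++ x , length y) ≡ x ++ y
    rotate≡ = cong₂ _++_ (drop-length-++ y x) (take-length-++ y x)

  length-dyckPaths*[a+b] : length D * n ≡ n C a
  length-dyckPaths*[a+b] = begin
    length D * n                     ≡⟨ cong (length D *_) (length-upTo n) ⟨
    length D * length (upTo n)       ≡⟨ length-cartesianProduct D (upTo n) ⟨
    length splits                    ≡⟨ length-map rotate splits ⟨
    length (map rotate splits)       ≡⟨ Unique-⊆-⊇⇒length≡ Unique-rotations
                                          (Unique.filter⁺ (λ w → countN w ≟ a) (Unique-words n))
                                          rotations⊆withNorth withNorth⊆rotations ⟩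
    length (withNorth a (words n))   ≡⟨ length-withNorth-words n a ⟩
    n C a                            ∎
    where open ≡-Reasoning

  length-dyckPaths : length D * (a ! * b !) ≡ (n ∸ 1) !
  length-dyckPaths = subst (λ c → length D * (a ! * c !) ≡ (n ∸ 1) !) (m+n∸m≡n a b)
    (L*n≡nCk⇒L*k!*[n∸k]!≡[n∸1]! {length D} (<-≤-trans 0<a (m≤m+n a b)) (m≤m+n a b) length-dyckPaths*[a+b])

-- The facets of Ass(a,b)

module _ {a b : ℕ} (0<a : 0 < a) (a<b : a < b) (cop : Coprime a b) where

  private
    dyck : ∀ {w} → w ∈ dyckPaths a b → IsDyck a b w
    dyck = proj₁ ∘ ∈-dyckPaths⁻ 0<a cop

  generators-maximal : All (Maximal (generators a b)) (generators a b)
  generators-maximal = map⁺ (All.tabulate λ {w} w∈ → map⁺ (All.tabulate λ w′∈ F⊆F′ →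
    subst (λ v → F a b v ⊆ˢ F a b w) (F-injective 0<a a<b cop (dyck w∈) (dyck w′∈) (All.lookup F⊆F′))
      (All.tabulate id)))

  generators-distinct : AllPairs (λ S T → ¬ S ≈ˢ T) (generators a b)
  generators-distinct = AllPairs-map-∈ (F a b)
    (λ w∈ w′∈ w≢w′ F≈F′ → w≢w′ (F-injective 0<a a<b cop (dyck w∈) (dyck w′∈) (All.lookup (proj₁ F≈F′))))
    (Unique.filter⁺ (isDyck? a b) (Unique-words (a + b)))

  facets≡generators : facets a b ≡ generators a b
  facets≡generators =
    trans (cong (deduplicate _≈ˢ?_) (filter-all (maximal? (generators a b)) generators-maximal))
          (deduplicate-AllPairs _≈ˢ?_ (generators a b) generators-distinct)

  dim-generators : All (λ S → dim S ≡ + a ℤ.- + 2) (generators a b)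
  dim-generators = map⁺ (All.tabulate λ w∈ →
    trans (cong (λ c → + c ℤ.- + 1) (card-F 0<a a<b cop (dyck w∈))) (+[a∸1]-1≡+a-2 a 0<a))
    where
    +[a∸1]-1≡+a-2 : ∀ a → 0 < a → + (a ∸ 1) ℤ.- + 1 ≡ + a ℤ.- + 2
    +[a∸1]-1≡+a-2 (suc a) _ = sym (ℤP.[1+m]⊖[1+n]≡m⊖n a 1)

proposition4p4 : (a b : ℕ) → 0 < a → a < b → Coprime a b →
    PureOfDimension (facets a b) (+ a ℤ.- + 2)
      × (length (facets a b) * (a ! * b !) ≡ (a + b ∸ 1) !)
proposition4p4 a b 0<a a<b cop rewrite facets≡generators 0<a a<b cop =
  dim-generators 0<a a<b cop ,
  trans (cong (_* (a ! * b !)) (length-map (F a b) (dyckPaths a b))) (length-dyckPaths 0<a cop)
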